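{- Let $\mathcal{X}$ be $Free(\{P_3+P_2,orb\})$ or $Free(\{P_3+P_2,K_5\})$, and let $G=G(A,B)$ be an irreducible graph with respect to $\mathcal{X}$. Then $\gamma''(G)=\gamma''_4(G)$.
   Context: $P_3+P_2$ is the disjoint union of paths on 3 and 2 vertices; $orb$ is obtained from $K_4$ by adding a new vertex adjacent to exactly one vertex of the $K_4$; $Free(\mathcal{F})$ is the class of graphs with no induced subgraph isomorphic to a member of $\mathcal{F}$. A graph $G$ with a partition $V(G)=A\cup B$ (written $G(A,B)$) is irreducible with respect to $\mathcal{X}$ if: $G\in\mathcal{X}$; $B$ is independent; no vertex of $B$ has degree one; there are no two distinct $u,v\in A$ with $N(u)\setminus A\subseteq N(v)\setminus A$; no vertex of $B$ is adjacent to all vertices of $A$; and $A$ is partitioned into (possibly empty) sets $A_1,A_2,A_3$ such that adding two new vertices $x,y$ and all edges $xx'$ for $x'\in A_1\cup A_3$ and $yy'$ for $y'\in A_2\cup A_3$ yields a graph in $\mathcal{X}$. $\gamma''(G)$ is the minimum cardinality of a subset of $A$ such that every vertex of $B$ has a neighbor in it; $\gamma''_4(G)$ is the minimum size of such a subset $D$ additionally requiring $G[D]$ to be complete multipartite with at most 4 parts ($+\infty$ if none exists). -}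

module Defs where

open import Data.Nat using (ℕ; zero; suc; _≤_)
open import Data.Bool using (Bool; true; false; _∧_; _∨_; not)
open import Data.Fin using (Fin; zero; suc; _≟_)
open import Data.Fin.Subset using (Subset; _∈_; _∉_; ∣_∣)
open import Data.Vec using (lookup)
open import Data.List using (List; []; _∷_; length; filterᵇ; allFin)
import Data.List.Membership.Propositional as L
open import Data.Maybe using (Maybe; just; nothing)
open import Data.Product using (Σ; ∃; _×_; _,_)
open import Function.Definitions using (Injective)
open import Relation.Binary.PropositionalEquality using (_≡_)
open import Relation.Nullary using (¬_)
open import Relation.Nullary.Decidable using (⌊_⌋)

-- A finite simple graph on vertex set Fin size.  The adjacency is the
-- symmetric, irreflexive closure of an arbitrary Boolean relation `edge`.
record Graph : Set where
  field
    size : ℕ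
    edge : Fin size → Fin size → Bool

  adj : Fin size → Fin size → Bool
  adj u v = (edge u v ∨ edge v u) ∧ not ⌊ u ≟ v ⌋

open Graph public

degree : (G : Graph) → Fin (size G) → ℕ
degree G v = length (filterᵇ (adj G v) (allFin (size G)))

InducedSub : Graph → Graph → Set
InducedSub H G =
  Σ (Fin (size H) → Fin (size G)) λ f →
    Injective _≡_ _≡_ f × (∀ u v → adj G (f u) (f v) ≡ adj H u v)

Free : List Graph → Graph → Set
Free F G = ∀ H → H L.∈ F → ¬ InducedSub H G

P3+P2 : Graph
P3+P2 = record { size = 5 ; edge = e }
  where
  e : Fin 5 → Fin 5 → Bool
  e zero (suc zero) = true
  e (suc zero) (suc (suc zero)) = true
  e (suc (suc (suc zero))) (suc (suc (suc (suc zero)))) = true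
  e _ _ = false

-- orb : K4 on {0,1,2,3} plus vertex 4 adjacent only to 0
orb : Graph
orb = record { size = 5 ; edge = e }
  where
  e : Fin 5 → Fin 5 → Bool
  e (suc (suc (suc (suc zero)))) zero = true
  e (suc (suc (suc (suc zero)))) _ = false
  e _ (suc (suc (suc (suc zero)))) = false
  e _ _ = true

K5 : Graph
K5 = record { size = 5 ; edge = λ _ _ → true }

-- Labels of A-vertices: zero ↦ A₁, suc zero ↦ A₂, suc (suc zero) ↦ A₃
in13 : Fin 3 → Bool
in13 zero = true
in13 (suc zero) = false
in13 (suc (suc zero)) = true

in23 : Fin 3 → Bool
in23 zero = false
in23 (suc zero) = true
in23 (suc (suc zero)) = true

-- G with two new vertices x (= zero) and y (= suc zero), x adjacent to
-- A₁ ∪ A₃ and y adjacent to A₂ ∪ A₃ (x,y nonadjacent); old vertex v is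
-- suc (suc v).
extend : (G : Graph) → Subset (size G) → (Fin (size G) → Fin 3) → Graph
extend G A lab = record { size = suc (suc (size G)) ; edge = e }
  where
  e : Fin (suc (suc (size G))) → Fin (suc (suc (size G))) → Bool
  e (suc (suc u)) (suc (suc v)) = adj G u v
  e zero (suc (suc v)) = lookup A v ∧ in13 (lab v)
  e (suc zero) (suc (suc v)) = lookup A v ∧ in23 (lab v)
  e _ _ = false

-- G(A,B) with B = complement of A, irreducible w.r.t. the class X
record Irreducible (X : Graph → Set) (G : Graph) (A : Subset (size G)) : Set where
  field
    inClass     : X G
    B-indep     : ∀ u v → u ∉ A → v ∉ A → adj G u v ≡ false
    B-deg≠1     : ∀ b → b ∉ A → ¬ (degree G b ≡ 1)
    A-noDomin   : ∀ u v → u ∈ A → v ∈ A → ¬ (u ≡ v) →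
                  ¬ (∀ w → w ∉ A → adj G u w ≡ true → adj G v w ≡ true)
    B-notFull   : ∀ b → b ∉ A → ¬ (∀ a → a ∈ A → adj G a b ≡ true)
    extendable  : Σ (Fin (size G) → Fin 3) λ lab → X (extend G A lab)

Dominates : (G : Graph) → Subset (size G) → Subset (size G) → Set
Dominates G A D =
  (∀ v → v ∈ D → v ∈ A) ×
  (∀ b → b ∉ A → ∃ λ d → d ∈ D × adj G b d ≡ true)

-- G[D] is complete multipartite with at most 4 parts (parts = colour classes,
-- possibly empty)
CompleteMultipartite≤4 : (G : Graph) → Subset (size G) → Set
CompleteMultipartite≤4 G D =
  Σ (Fin (size G) → Fin 4) λ c →
    ∀ u v → u ∈ D → v ∈ D → ¬ (u ≡ v) →
      (adj G u v ≡ true → ¬ (c u ≡ c v)) × (¬ (c u ≡ c v) → adj G u v ≡ true)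

-- MinCard P m : m is the minimum cardinality of a subset satisfying P,
-- with nothing standing for +∞ (no such subset).
MinCard : {n : ℕ} → (Subset n → Set) → Maybe ℕ → Set
MinCard {n} P (just k) =
  (∃ λ D → P D × ∣ D ∣ ≡ k) × (∀ D → P D → k ≤ ∣ D ∣)
MinCard {n} P nothing = ∀ D → ¬ P D

γ''-is : (G : Graph) → Subset (size G) → Maybe ℕ → Set
γ''-is G A = MinCard (Dominates G A)

γ''₄-is : (G : Graph) → Subset (size G) → Maybe ℕ → Set
γ''₄-is G A = MinCard (λ D → Dominates G A D × CompleteMultipartite≤4 G D)

module Submission where

-- We show γ''(G) = γ''₄(G) by proving that every
-- MINIMUM dominating set D ⊆ A of B is already complete multipartite
-- with at most four parts.  Only two properties of G are used: B is
-- independent and G itself lies in the class.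
--
--  * A minimum dominating set exists as soon as any dominating set does
--    (`minimum`), and each d ∈ D then has a private neighbour b ∈ B whose
--    only neighbour in D is d (`privateNeighbour`).
--  * Non-adjacency is transitive on D: otherwise x–z adjacent, y
--    non-adjacent to both, together with private neighbours of x and y,
--    induce a P3+P2 (`nonadjacency-transitive`).
--  * D contains no K5: in the K5 case directly, in the orb case already
--    four pairwise adjacent vertices plus a private neighbour induce orb.
--  * A vertex set on which non-adjacency is transitive and which spans no
--    K5 induces a complete multipartite graph with at most four parts
--    (`completeMultipartite`): colour v by the first of three pairwise
--    adjacent representatives it is not adjacent to.

open import Defs
open import Data.Bool using (Bool; true; false; not; _∧_; _∨_)
open import Data.Bool.Properties using (∨-comm; ∧-zeroʳ; ¬-not) renaming (_≟_ to _≟ᵇ_)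
open import Data.Empty using (⊥-elim)
open import Data.Fin using (Fin; zero; suc; _≟_; _<_; #_)
open import Data.Fin.Properties using (any?; all?; <-cmp)
open import Data.Fin.Subset using (Subset; _∈_; _∉_; ∣_∣; _-_; ⁅_⁆)
open import Data.Fin.Subset.Properties
  using (_∈?_; anySubset?; x∈p⇒∣p-x∣<∣p∣; x∈p∧x≢y⇒x∈p-y; p─q⊆p; ∣p∣≤n)
open import Data.List using (List; []; _∷_)
open import Data.List.Relation.Unary.Any using (here; there)
open import Data.Maybe using (Maybe; just; nothing)
open import Data.Nat using (ℕ; zero; suc; _≤_; z≤n; s≤s; _<?_)
open import Data.Nat.Properties using (≮⇒≥; <⇒≱; <-≤-trans; ≤-pred; ≤-trans)
open import Data.Product using (Σ; ∃; _×_; _,_; proj₁; proj₂)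
open import Data.Sum using (_⊎_; inj₁; inj₂)
open import Data.Vec using (Vec; []; _∷_; lookup)
open import Data.Vec.Properties using ([]=⇒lookup; lookup⇒[]=)
open import Data.Vec.Relation.Unary.All using (All; []; _∷_)
open import Data.Vec.Relation.Unary.All.Properties using (lookup⁺)
open import Data.Vec.Relation.Binary.Pointwise.Inductive as Pointwise
  using (Pointwise; []; _∷_)
open import Function.Definitions using (Injective)
open import Relation.Binary using (tri<; tri≈; tri>)
open import Relation.Binary.PropositionalEquality
  using (_≡_; _≢_; refl; sym; trans; cong; subst; module ≡-Reasoning)
open import Relation.Nullary using (¬_; Dec; yes; no; contradiction)
open import Relation.Nullary.Decidable
  using (⌊_⌋; _→-dec_; _×-dec_; _⊎-dec_; ¬?; toWitness)
open import Relation.Unary using (Decidable)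

adj-sym : (G : Graph) (u v : Fin (size G)) → adj G u v ≡ adj G v u
adj-sym G u v = helper (edge G u v) (edge G v u) (u ≟ v) (v ≟ u)
  where
  helper : ∀ a b (d : Dec (u ≡ v)) (d′ : Dec (v ≡ u)) →
           (a ∨ b) ∧ not ⌊ d ⌋ ≡ (b ∨ a) ∧ not ⌊ d′ ⌋
  helper a b (yes _)   (yes _)   = cong (_∧ false) (∨-comm a b)
  helper a b (no _)    (no _)    = cong (_∧ true) (∨-comm a b)
  helper a b (yes u≡v) (no v≢u)  = contradiction (sym u≡v) v≢u
  helper a b (no u≢v)  (yes v≡u) = contradiction (sym v≡u) u≢v

adj-irr : (G : Graph) (u : Fin (size G)) → adj G u u ≡ false
adj-irr G u with u ≟ u
... | yes _  = ∧-zeroʳ _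
... | no u≢u = contradiction refl u≢u

adjacent⇒distinct : (G : Graph) {u v : Fin (size G)} → adj G u v ≡ true → u ≢ v
adjacent⇒distinct G {u} uv refl = contradiction (trans (sym uv) (adj-irr G u)) λ ()

adj-swap : (G : Graph) {u v : Fin (size G)} {b : Bool} → adj G u v ≡ b → adj G v u ≡ b
adj-swap G {u} {v} uv = trans (adj-sym G v u) uv

told-apart : (G : Graph) {u v w : Fin (size G)} →
             adj G u w ≡ true → adj G v w ≡ false → u ≢ v
told-apart G uw vw refl = contradiction (trans (sym uw) vw) λ ()

∈⇒true : ∀ {n} {x : Fin n} {p : Subset n} → x ∈ p → lookup p x ≡ true
∈⇒true = []=⇒lookup

∉⇒false : ∀ {n} {x : Fin n} {p : Subset n} → x ∉ p → lookup p x ≡ false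
∉⇒false {x = x} {p} x∉p with lookup p x in eq
... | true  = contradiction (lookup⇒[]= x p eq) x∉p
... | false = refl

choose : ∀ {n} (P : Fin n → Set) → Decidable P → Fin n → Fin n
choose P P? default with any? P?
... | yes (x , _) = x
... | no _        = default

chosen : ∀ {n} (P : Fin n → Set) (P? : Decidable P) (default : Fin n) {u : Fin n} →
         P u → P (choose P P? default)
chosen P P? default Pu with any? P?
... | yes (_ , Px) = Px
... | no none      = contradiction (_ , Pu) none

IsMinimum : ∀ {n} → (Subset n → Set) → Subset n → Set
IsMinimum P D = P D × (∀ D′ → P D′ → ∣ D ∣ ≤ ∣ D′ ∣)

minimum : ∀ {n} {P : Subset n → Set} → Decidable P → ∀ {D} → P D → ∃ (IsMinimum P)
minimum {n} {P} P? {D} = below n D (∣p∣≤n D)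
  where
  -- descend through strictly smaller satisfying subsets
  below : ∀ k D → ∣ D ∣ ≤ k → P D → ∃ (IsMinimum P)
  below zero D ∣D∣≤0 PD = D , PD , λ _ _ → ≤-trans ∣D∣≤0 z≤n
  below (suc k) D ∣D∣≤k PD with anySubset? (λ D′ → P? D′ ×-dec (∣ D′ ∣ <? ∣ D ∣))
  ... | yes (D′ , PD′ , smaller) = below k D′ (≤-pred (<-≤-trans smaller ∣D∣≤k)) PD′
  ... | no none = D , PD , λ D′ PD′ → ≮⇒≥ (λ smaller → none (D′ , PD′ , smaller))

-- A map respecting
-- adjacency is injective as soon as any two distinct vertices of H are told
-- apart by a labelling (here: membership in A) or by adjacency to a vertex.

Separates : (H : Graph) → (Fin (size H) → Bool) → Set
Separates H lab =
  ∀ i j → i ≡ j ⊎ lab i ≢ lab j ⊎ ∃ λ k → adj H i k ≢ adj H j k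

separates? : (H : Graph) (lab : Fin (size H) → Bool) → Dec (Separates H lab)
separates? H lab = all? λ i → all? λ j →
  (i ≟ j) ⊎-dec (¬? (lab i ≟ᵇ lab j) ⊎-dec any? (λ k → ¬? (adj H i k ≟ᵇ adj H j k)))

fromUpper : (G H : Graph) (f : Fin (size H) → Fin (size G)) →
            (∀ i j → i < j → adj G (f i) (f j) ≡ adj H i j) →
            ∀ i j → adj G (f i) (f j) ≡ adj H i j
fromUpper G H f upper i j with <-cmp i j
... | tri< i<j _ _ = upper i j i<j
... | tri≈ _ refl _ = trans (adj-irr G (f i)) (sym (adj-irr H i))
... | tri> _ _ j<i = begin
  adj G (f i) (f j) ≡⟨ adj-sym G (f i) (f j) ⟩
  adj G (f j) (f i) ≡⟨ upper j i j<i ⟩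
  adj H j i         ≡⟨ adj-sym H j i ⟩
  adj H i j         ∎
  where open ≡-Reasoning

induced : (G : Graph) (A : Subset (size G)) (H : Graph) (lab : Fin (size H) → Bool) →
          Separates H lab → (f : Fin (size H) → Fin (size G)) →
          (∀ i → lookup A (f i) ≡ lab i) →
          (∀ i j → i < j → adj G (f i) (f j) ≡ adj H i j) → InducedSub H G
induced G A H lab sep f labels upper = f , injective , adjacency
  where
  adjacency : ∀ i j → adj G (f i) (f j) ≡ adj H i j
  adjacency = fromUpper G H f upper
  injective : Injective _≡_ _≡_ f
  injective {i} {j} fi≡fj with sep i j
  ... | inj₁ i≡j = i≡j
  ... | inj₂ (inj₁ lab≢) =
    contradiction (trans (sym (labels i)) (trans (cong (lookup A) fi≡fj) (labels j))) lab≢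
  ... | inj₂ (inj₂ (k , adj≢)) = contradiction
    (trans (sym (adjacency i k)) (trans (cong (λ w → adj G w (f k)) fi≡fj) (adjacency j k)))
    adj≢

record Induces5 (G : Graph) (vs : Vec (Fin (size G)) 5) (h : Fin 5 → Fin 5 → Bool) : Set where
  field
    e₀₁ : adj G (lookup vs (# 0)) (lookup vs (# 1)) ≡ h (# 0) (# 1)
    e₀₂ : adj G (lookup vs (# 0)) (lookup vs (# 2)) ≡ h (# 0) (# 2)
    e₀₃ : adj G (lookup vs (# 0)) (lookup vs (# 3)) ≡ h (# 0) (# 3)
    e₀₄ : adj G (lookup vs (# 0)) (lookup vs (# 4)) ≡ h (# 0) (# 4)
    e₁₂ : adj G (lookup vs (# 1)) (lookup vs (# 2)) ≡ h (# 1) (# 2)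
    e₁₃ : adj G (lookup vs (# 1)) (lookup vs (# 3)) ≡ h (# 1) (# 3)
    e₁₄ : adj G (lookup vs (# 1)) (lookup vs (# 4)) ≡ h (# 1) (# 4)
    e₂₃ : adj G (lookup vs (# 2)) (lookup vs (# 3)) ≡ h (# 2) (# 3)
    e₂₄ : adj G (lookup vs (# 2)) (lookup vs (# 4)) ≡ h (# 2) (# 4)
    e₃₄ : adj G (lookup vs (# 3)) (lookup vs (# 4)) ≡ h (# 3) (# 4)

upper5 : ∀ {G vs h} → Induces5 G vs h →
         ∀ i j → i < j → adj G (lookup vs i) (lookup vs j) ≡ h i j
upper5 e zero (suc zero) _ = Induces5.e₀₁ e
upper5 e zero (suc (suc zero)) _ = Induces5.e₀₂ e
upper5 e zero (suc (suc (suc zero))) _ = Induces5.e₀₃ e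
upper5 e zero (suc (suc (suc (suc zero)))) _ = Induces5.e₀₄ e
upper5 e (suc zero) (suc (suc zero)) _ = Induces5.e₁₂ e
upper5 e (suc zero) (suc (suc (suc zero))) _ = Induces5.e₁₃ e
upper5 e (suc zero) (suc (suc (suc (suc zero)))) _ = Induces5.e₁₄ e
upper5 e (suc (suc zero)) (suc (suc (suc zero))) _ = Induces5.e₂₃ e
upper5 e (suc (suc zero)) (suc (suc (suc (suc zero)))) _ = Induces5.e₂₄ e
upper5 e (suc (suc (suc zero))) (suc (suc (suc (suc zero)))) _ = Induces5.e₃₄ e
upper5 e _ zero ()
upper5 e (suc _) (suc zero) (s≤s ())
upper5 e (suc (suc _)) (suc (suc zero)) (s≤s (s≤s ()))
upper5 e (suc (suc (suc _))) (suc (suc (suc zero))) (s≤s (s≤s (s≤s ())))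
upper5 e (suc (suc (suc (suc _)))) (suc (suc (suc (suc zero)))) (s≤s (s≤s (s≤s (s≤s ()))))

-- The patterns with the A-membership of their vertices in our copies
-- (true = in A; all of K5 lies in A); these labellings separate the vertices.

labels-P3+P2 labels-orb : Vec Bool 5
labels-P3+P2 = false ∷ true ∷ true ∷ true ∷ false ∷ []
labels-orb   = true ∷ true ∷ true ∷ true ∷ false ∷ []

separates-P3+P2 : Separates P3+P2 (lookup labels-P3+P2)
separates-P3+P2 = toWitness {a? = separates? P3+P2 (lookup labels-P3+P2)} _

separates-orb : Separates orb (lookup labels-orb)
separates-orb = toWitness {a? = separates? orb (lookup labels-orb)} _

separates-K5 : Separates K5 (λ _ → true)
separates-K5 = toWitness {a? = separates? K5 (λ _ → true)} _

Clique5In : (G : Graph) → Subset (size G) → Set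
Clique5In G D = Σ (Vec (Fin (size G)) 5) λ vs → All (_∈ D) vs × Induces5 G vs (adj K5)

module _ (G : Graph) (D : Subset (size G))
         (nonadj-trans : ∀ {x y z} → x ∈ D → y ∈ D → z ∈ D →
                         adj G x y ≡ false → adj G y z ≡ false → adj G x z ≡ false)
         (K5-free : ¬ Clique5In G D) where

  across : ∀ {r u v} → r ∈ D → u ∈ D → v ∈ D →
           adj G r u ≡ false → adj G r v ≡ true → adj G u v ≡ true
  across {u = u} {v} r∈D u∈D v∈D ru rv with adj G u v in uv
  ... | true  = refl
  ... | false = contradiction (trans (sym rv) (nonadj-trans r∈D u∈D v∈D ru uv)) λ ()

  across′ : ∀ {r u v} → r ∈ D → u ∈ D → v ∈ D →
            adj G r u ≡ true → adj G r v ≡ false → adj G u v ≡ true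
  across′ r∈D u∈D v∈D ru rv = adj-swap G (across r∈D v∈D u∈D rv ru)

  through : ∀ {r u v} → r ∈ D → u ∈ D → v ∈ D →
            adj G r u ≡ false → adj G r v ≡ false → adj G u v ≡ false
  through r∈D u∈D v∈D ru rv = nonadj-trans u∈D r∈D v∈D (adj-swap G ru) rv

  -- The parts are found from pairwise adjacent representatives r₁, r₂, r₃.
  module Representatives (r₁ : Fin (size G)) (r₁∈D : r₁ ∈ D) where

    NeighbourOf₁ : Fin (size G) → Set
    NeighbourOf₁ v = v ∈ D × adj G r₁ v ≡ true

    r₂ : Fin (size G)
    r₂ = choose NeighbourOf₁ (λ v → (v ∈? D) ×-dec (adj G r₁ v ≟ᵇ true)) r₁

    NeighbourOf₁₂ : Fin (size G) → Set
    NeighbourOf₁₂ v = v ∈ D × adj G r₁ v ≡ true × adj G r₂ v ≡ true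

    r₃ : Fin (size G)
    r₃ = choose NeighbourOf₁₂
      (λ v → (v ∈? D) ×-dec ((adj G r₁ v ≟ᵇ true) ×-dec (adj G r₂ v ≟ᵇ true))) r₁

    r₂-spec : ∀ {v} → v ∈ D → adj G r₁ v ≡ true → NeighbourOf₁ r₂
    r₂-spec v∈D r₁v = chosen NeighbourOf₁ _ r₁ (v∈D , r₁v)

    r₃-spec : ∀ {v} → v ∈ D → adj G r₁ v ≡ true → adj G r₂ v ≡ true → NeighbourOf₁₂ r₃
    r₃-spec v∈D r₁v r₂v = chosen NeighbourOf₁₂ _ r₁ (v∈D , r₁v , r₂v)

    colour : Fin (size G) → Fin 4
    colour v with adj G r₁ v | adj G r₂ v | adj G r₃ v
    ... | false | _     | _     = # 0
    ... | true  | false | _     = # 1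
    ... | true  | true  | false = # 2
    ... | true  | true  | true  = # 3

    data Part (v : Fin (size G)) : Fin 4 → Set where
      part₀ : adj G r₁ v ≡ false → Part v (# 0)
      part₁ : r₂ ∈ D → adj G r₁ v ≡ true → adj G r₂ v ≡ false → Part v (# 1)
      part₂ : r₃ ∈ D → adj G r₁ v ≡ true → adj G r₂ v ≡ true → adj G r₃ v ≡ false →
              Part v (# 2)
      part₃ : NeighbourOf₁ r₂ → NeighbourOf₁₂ r₃ →
              adj G r₁ v ≡ true → adj G r₂ v ≡ true → adj G r₃ v ≡ true → Part v (# 3)

    part : ∀ {v} → v ∈ D → Part v (colour v)
    part {v} v∈D with adj G r₁ v in r₁v | adj G r₂ v in r₂v | adj G r₃ v in r₃v
    ... | false | _     | _     = part₀ r₁v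
    ... | true  | false | _     = part₁ (proj₁ (r₂-spec v∈D r₁v)) r₁v r₂v
    ... | true  | true  | false = part₂ (proj₁ (r₃-spec v∈D r₁v r₂v)) r₁v r₂v r₃v
    ... | true  | true  | true  = part₃ (r₂-spec v∈D r₁v) (r₃-spec v∈D r₁v r₂v) r₁v r₂v r₃v

    module _ {u v : Fin (size G)} (u∈D : u ∈ D) (v∈D : v ∈ D) where

      -- each part is independent: by transitivity of non-adjacency, and in
      -- the last part because r₁, r₂, r₃, u, v would form a K5
      same-part : ∀ {k} → Part u k → Part v k → adj G u v ≡ false
      same-part (part₀ r₁u) (part₀ r₁v) = through r₁∈D u∈D v∈D r₁u r₁v
      same-part (part₁ r₂∈D _ r₂u) (part₁ _ _ r₂v) = through r₂∈D u∈D v∈D r₂u r₂v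
      same-part (part₂ r₃∈D _ _ r₃u) (part₂ _ _ _ r₃v) = through r₃∈D u∈D v∈D r₃u r₃v
      same-part (part₃ (r₂∈D , r₁r₂) (r₃∈D , r₁r₃ , r₂r₃) r₁u r₂u r₃u)
                (part₃ _ _ r₁v r₂v r₃v) with adj G u v in uv
      ... | false = refl
      ... | true  = ⊥-elim (K5-free
        ( (r₁ ∷ r₂ ∷ r₃ ∷ u ∷ v ∷ [])
        , (r₁∈D ∷ r₂∈D ∷ r₃∈D ∷ u∈D ∷ v∈D ∷ [])
        , record { e₀₁ = r₁r₂ ; e₀₂ = r₁r₃ ; e₀₃ = r₁u ; e₀₄ = r₁v
                 ; e₁₂ = r₂r₃ ; e₁₃ = r₂u ; e₁₄ = r₂v
                 ; e₂₃ = r₃u ; e₂₄ = r₃v ; e₃₄ = uv } ))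

      -- different parts are joined: the representative of the lower part
      -- sees exactly one of u, v
      different-parts : ∀ {k l} → Part u k → Part v l → k ≢ l → adj G u v ≡ true
      different-parts (part₀ _) (part₀ _) k≢l = contradiction refl k≢l
      different-parts (part₀ r₁u) (part₁ _ r₁v _) _ = across r₁∈D u∈D v∈D r₁u r₁v
      different-parts (part₀ r₁u) (part₂ _ r₁v _ _) _ = across r₁∈D u∈D v∈D r₁u r₁v
      different-parts (part₀ r₁u) (part₃ _ _ r₁v _ _) _ = across r₁∈D u∈D v∈D r₁u r₁v
      different-parts (part₁ _ r₁u _) (part₀ r₁v) _ = across′ r₁∈D u∈D v∈D r₁u r₁v
      different-parts (part₁ _ _ _) (part₁ _ _ _) k≢l = contradiction refl k≢l
      different-parts (part₁ r₂∈D _ r₂u) (part₂ _ _ r₂v _) _ = across r₂∈D u∈D v∈D r₂u r₂v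
      different-parts (part₁ r₂∈D _ r₂u) (part₃ _ _ _ r₂v _) _ = across r₂∈D u∈D v∈D r₂u r₂v
      different-parts (part₂ _ r₁u _ _) (part₀ r₁v) _ = across′ r₁∈D u∈D v∈D r₁u r₁v
      different-parts (part₂ _ _ r₂u _) (part₁ r₂∈D _ r₂v) _ = across′ r₂∈D u∈D v∈D r₂u r₂v
      different-parts (part₂ _ _ _ _) (part₂ _ _ _ _) k≢l = contradiction refl k≢l
      different-parts (part₂ r₃∈D _ _ r₃u) (part₃ _ _ _ _ r₃v) _ = across r₃∈D u∈D v∈D r₃u r₃v
      different-parts (part₃ _ _ r₁u _ _) (part₀ r₁v) _ = across′ r₁∈D u∈D v∈D r₁u r₁v
      different-parts (part₃ _ _ _ r₂u _) (part₁ r₂∈D _ r₂v) _ = across′ r₂∈D u∈D v∈D r₂u r₂v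
      different-parts (part₃ _ _ _ _ r₃u) (part₂ r₃∈D _ _ r₃v) _ = across′ r₃∈D u∈D v∈D r₃u r₃v
      different-parts (part₃ _ _ _ _ _) (part₃ _ _ _ _ _) k≢l = contradiction refl k≢l

  completeMultipartite : CompleteMultipartite≤4 G D
  completeMultipartite with any? (_∈? D)
  ... | no empty = (λ _ → # 0) , λ u _ u∈D _ _ → contradiction (u , u∈D) empty
  ... | yes (r₁ , r₁∈D) = colour , λ u v u∈D v∈D _ →
          (λ uv same → contradiction (trans (sym uv) (same-colour u∈D v∈D same)) λ ())
        , different-parts u∈D v∈D (part u∈D) (part v∈D)
    where
    open Representatives r₁ r₁∈D
    same-colour : ∀ {u v} → u ∈ D → v ∈ D → colour u ≡ colour v → adj G u v ≡ false
    same-colour {v = v} u∈D v∈D same =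
      same-part u∈D v∈D (part u∈D) (subst (Part v) (sym same) (part v∈D))

module _ (G : Graph) (A : Subset (size G)) where

  dominates? : Decidable (Dominates G A)
  dominates? D =
    all? (λ v → (v ∈? D) →-dec (v ∈? A)) ×-dec
    all? (λ b → ¬? (b ∈? A) →-dec any? (λ d → (d ∈? D) ×-dec (adj G b d ≟ᵇ true)))

  record PrivateNeighbour (D : Subset (size G)) (d : Fin (size G)) : Set where
    field
      vertex    : Fin (size G)
      outside   : vertex ∉ A
      adjacent  : adj G vertex d ≡ true
      exclusive : ∀ {d′} → d′ ∈ D → d′ ≢ d → adj G vertex d′ ≡ false

  OtherNeighbour : Subset (size G) → Fin (size G) → Fin (size G) → Set
  OtherNeighbour D d b = ∃ λ d′ → d′ ∈ D × d′ ≢ d × adj G b d′ ≡ true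

  otherNeighbour? : ∀ D d → Decidable (OtherNeighbour D d)
  otherNeighbour? D d b =
    any? λ d′ → (d′ ∈? D) ×-dec (¬? (d′ ≟ d) ×-dec (adj G b d′ ≟ᵇ true))

  -- In a minimum dominating set every vertex has a private neighbour,
  -- since otherwise D - d would still dominate B.
  privateNeighbour : ∀ {D} → IsMinimum (Dominates G A) D →
                     ∀ {d} → d ∈ D → PrivateNeighbour D d
  privateNeighbour {D} (dominating , least) {d} d∈D
    with any? (λ b → ¬? (b ∈? A) ×-dec ((adj G b d ≟ᵇ true) ×-dec ¬? (otherNeighbour? D d b)))
  ... | yes (b , b∉A , bd , no-other) = record
    { vertex    = b
    ; outside   = b∉A
    ; adjacent  = bd
    ; exclusive = λ {d′} d′∈D d′≢d → ¬-not λ bd′ → no-other (d′ , d′∈D , d′≢d , bd′)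
    }
  ... | no no-private =
    contradiction (least (D - d) dominating-without-d) (<⇒≱ (x∈p⇒∣p-x∣<∣p∣ d∈D))
    where
    covered : ∀ b → b ∉ A → ∃ λ d′ → d′ ∈ D - d × adj G b d′ ≡ true
    covered b b∉A with proj₂ dominating b b∉A
    ... | d″ , d″∈D , bd″ with d″ ≟ d
    ...   | no d″≢d = d″ , x∈p∧x≢y⇒x∈p-y d″∈D d″≢d , bd″
    ...   | yes refl with otherNeighbour? D d b
    ...     | yes (d′ , d′∈D , d′≢d , bd′) = d′ , x∈p∧x≢y⇒x∈p-y d′∈D d′≢d , bd′
    ...     | no no-other = contradiction (b , b∉A , bd″ , no-other) no-private
    dominating-without-d : Dominates G A (D - d)
    dominating-without-d = (λ v v∈D-d → proj₁ dominating v (p─q⊆p D ⁅ d ⁆ v∈D-d)) , covered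

module _ (G : Graph) (A : Subset (size G)) (D : Subset (size G))
         (D⊆A : ∀ v → v ∈ D → v ∈ A) where

  in-A : ∀ {v} → v ∈ D → lookup A v ≡ true
  in-A v∈D = ∈⇒true (D⊆A _ v∈D)

  K5-free⇒clique-free : ¬ InducedSub K5 G → ¬ Clique5In G D
  K5-free⇒clique-free K5-free (vs , inD , edges) = K5-free
    (induced G A K5 (λ _ → true) separates-K5 (lookup vs)
             (λ i → in-A (lookup⁺ inD i)) (upper5 edges))

  module _ (private-nbr : ∀ {d} → d ∈ D → PrivateNeighbour G A D d) where

    -- x–z adjacent and y adjacent to neither: bx–x–z plus y–by is a P3+P2,
    -- where bx, by are private neighbours of x, y
    nonadjacency-transitive :
      ¬ InducedSub P3+P2 G → (∀ u v → u ∉ A → v ∉ A → adj G u v ≡ false) →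
      ∀ {x y z} → x ∈ D → y ∈ D → z ∈ D →
      adj G x y ≡ false → adj G y z ≡ false → adj G x z ≡ false
    nonadjacency-transitive P3+P2-free B-indep {x} {y} {z} x∈D y∈D z∈D xy yz
      with adj G x z in xz
    ... | false = refl
    ... | true  = ⊥-elim (P3+P2-free
          (induced G A P3+P2 (lookup labels-P3+P2) separates-P3+P2 (lookup vs)
                   (Pointwise.lookup labels) (upper5 edges)))
      where
      open PrivateNeighbour (private-nbr x∈D)
        renaming (vertex to bx; outside to bx∉A; adjacent to bx-x; exclusive to bx-only)
      open PrivateNeighbour (private-nbr y∈D)
        renaming (vertex to by; outside to by∉A; adjacent to by-y; exclusive to by-only)
      x≢y : x ≢ y
      x≢y = told-apart G xz yz
      y≢x : y ≢ x
      y≢x y≡x = x≢y (sym y≡x)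
      z≢x : z ≢ x
      z≢x = adjacent⇒distinct G (adj-swap G xz)
      z≢y : z ≢ y
      z≢y = told-apart G (adj-swap G xz) (adj-swap G xy)
      vs : Vec (Fin (size G)) 5
      vs = bx ∷ x ∷ z ∷ y ∷ by ∷ []
      labels : Pointwise (λ v l → lookup A v ≡ l) vs labels-P3+P2
      labels = ∉⇒false bx∉A ∷ in-A x∈D ∷ in-A z∈D ∷ in-A y∈D ∷ ∉⇒false by∉A ∷ []
      edges : Induces5 G vs (adj P3+P2)
      edges = record
        { e₀₁ = bx-x ; e₀₂ = bx-only z∈D z≢x
        ; e₀₃ = bx-only y∈D y≢x ; e₀₄ = B-indep bx by bx∉A by∉A
        ; e₁₂ = xz ; e₁₃ = xy ; e₁₄ = adj-swap G (by-only x∈D x≢y)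
        ; e₂₃ = adj-swap G yz ; e₂₄ = adj-swap G (by-only z∈D z≢y)
        ; e₃₄ = adj-swap G by-y }

    -- four vertices of a K5 in D with a private neighbour of the first one
    -- induce orb
    orb-free⇒clique-free : ¬ InducedSub orb G → ¬ Clique5In G D
    orb-free⇒clique-free orb-free
      ((a₀ ∷ a₁ ∷ a₂ ∷ a₃ ∷ _ ∷ []) , (a₀∈D ∷ a₁∈D ∷ a₂∈D ∷ a₃∈D ∷ _ ∷ []) , clique) =
      orb-free (induced G A orb (lookup labels-orb) separates-orb (lookup vs)
                        (Pointwise.lookup labels) (upper5 edges))
      where
      open Induces5 clique
      open PrivateNeighbour (private-nbr a₀∈D)
        renaming (vertex to b; outside to b∉A; adjacent to b-a₀; exclusive to b-only)
      distinct-from-a₀ : ∀ {a} → adj G a₀ a ≡ true → a ≢ a₀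
      distinct-from-a₀ a₀a = adjacent⇒distinct G (adj-swap G a₀a)
      vs : Vec (Fin (size G)) 5
      vs = a₀ ∷ a₁ ∷ a₂ ∷ a₃ ∷ b ∷ []
      labels : Pointwise (λ v l → lookup A v ≡ l) vs labels-orb
      labels = in-A a₀∈D ∷ in-A a₁∈D ∷ in-A a₂∈D ∷ in-A a₃∈D ∷ ∉⇒false b∉A ∷ []
      edges : Induces5 G vs (adj orb)
      edges = record
        { e₀₁ = e₀₁ ; e₀₂ = e₀₂ ; e₀₃ = e₀₃ ; e₀₄ = adj-swap G b-a₀
        ; e₁₂ = e₁₂ ; e₁₃ = e₁₃ ; e₁₄ = adj-swap G (b-only a₁∈D (distinct-from-a₀ e₀₁))
        ; e₂₃ = e₂₃ ; e₂₄ = adj-swap G (b-only a₂∈D (distinct-from-a₀ e₀₂))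
        ; e₃₄ = adj-swap G (b-only a₃∈D (distinct-from-a₀ e₀₃)) }

Class : List Graph → Set
Class F = F ≡ P3+P2 ∷ orb ∷ [] ⊎ F ≡ P3+P2 ∷ K5 ∷ []

P3+P2-forbidden : ∀ {F G} → Class F → Free F G → ¬ InducedSub P3+P2 G
P3+P2-forbidden (inj₁ refl) free = free P3+P2 (here refl)
P3+P2-forbidden (inj₂ refl) free = free P3+P2 (here refl)

clique-forbidden : ∀ {F G A D} → Class F → Free F G → (D⊆A : ∀ v → v ∈ D → v ∈ A) →
                   (∀ {d} → d ∈ D → PrivateNeighbour G A D d) → ¬ Clique5In G D
clique-forbidden {G = G} {A} {D} (inj₁ refl) free D⊆A private-nbr =
  orb-free⇒clique-free G A D D⊆A private-nbr (free orb (there (here refl)))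
clique-forbidden {G = G} {A} {D} (inj₂ refl) free D⊆A _ =
  K5-free⇒clique-free G A D D⊆A (free K5 (there (here refl)))

lemma8 : (F : List Graph) →
    (F ≡ P3+P2 ∷ orb ∷ [] ⊎ F ≡ P3+P2 ∷ K5 ∷ []) →
    (G : Graph) (A : Subset (size G)) →
    Irreducible (Free F) G A →
    ∃ λ (m : Maybe ℕ) → γ''-is G A m × γ''₄-is G A m
lemma8 F hF G A irr with anySubset? (dominates? G A)
... | no none = nothing , (λ D dom → none (D , dom)) , (λ D dom₄ → none (D , proj₁ dom₄))
... | yes (_ , dom₀) with minimum (dominates? G A) dom₀
...   | D , dom , least =
  just ∣ D ∣ , ((D , dom , refl) , least)
             , ((D , (dom , multipartite) , refl) , λ D′ dom₄′ → least D′ (proj₁ dom₄′))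
  where
  open Irreducible irr using (inClass; B-indep)
  D⊆A : ∀ v → v ∈ D → v ∈ A
  D⊆A = proj₁ dom
  private-nbr : ∀ {d} → d ∈ D → PrivateNeighbour G A D d
  private-nbr = privateNeighbour G A (dom , least)
  multipartite : CompleteMultipartite≤4 G D
  multipartite = completeMultipartite G D
    (nonadjacency-transitive G A D D⊆A private-nbr (P3+P2-forbidden {G = G} hF inClass) B-indep)
    (clique-forbidden {G = G} hF inClass D⊆A private-nbr)
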